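{- Let $G$ be an oriented graph derived from a Burling tree $T$ whose underlying graph is a domino with holes $H_1,H_2$ and edge $xy$. Then for some $z\in\{x,y\}$ and some $i\in\{1,2\}$, $z$ is the pivot of $H_i$ and $z$ is a subordinate vertex of $H_{3-i}$.
   Context: Rooted trees: for a rooted tree $(T,r)$ and $v\neq r$, $p(v)$ is the parent of $v$. A branch is a path $v_1v_2\dots v_k$ of $T$ with $v_i$ the parent of $v_{i+1}$ for all $i$ (it starts at $v_1$); a branch may be empty. Ancestors of $v$ are vertices on the path from $v$ to the root (including $v$); strict = other than $v$. A Burling tree is a 4-tuple $(T,r,\ell,c)$ where $T$ is a rooted tree with root $r$; $\ell$ assigns to every non-leaf vertex $v$ one of its children $\ell(v)$, the last-born of $v$; and $c$ is a function on $V(T)$ such that if $v\neq r$ is not a last-born then $c(v)$ is the vertex set of a (possibly empty) branch of $T$ starting at $\ell(p(v))$, while $c(v)=\varnothing$ if $v$ is the root or a last-born. The oriented graph fully derived from the Burling tree has vertex set $V(T)$ and an arc $uv$ iff $v\in c(u)$. An oriented graph is derived from the Burling tree if it is an induced subgraph of the fully derived oriented graph. A hole is an induced subgraph whose underlying graph is a cycle of length at least $4$. For a hole $H$ of $G$, let $S_H$ be the set of vertices $x$ of $H$ such that no strict ancestor of $x$ in $T$ lies in $H$. It is a fact that $H[S_H]$ consists of a vertex $p$ and two vertices $a,a'$ with arcs $ap,a'p$; $p$ is the pivot of $H$ and $a,a'$ are its antennas. A subordinate vertex of $H$ is a vertex of $H$ other than its pivot and its antennas. A domino is a graph consisting of an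 edge $xy$ and two holes $H_1,H_2$ both containing the edge $xy$, with $V(H_1)\cap V(H_2)=\{x,y\}$ and no edges other than those of $H_1$ and $H_2$. -}

module Defs where

open import Data.Nat using (ℕ; zero; suc; _≤_)
open import Data.Fin using (Fin; toℕ)
open import Data.Product using (Σ; ∃; ∃-syntax; _×_; _,_)
open import Data.Sum using (_⊎_)
open import Data.Unit using (⊤)
open import Data.List using (List; []; _∷_)
open import Data.List.Membership.Propositional using (_∈_)
open import Relation.Nullary using (¬_)
open import Relation.Binary.PropositionalEquality using (_≡_; _≢_)
open import Function using (_⇔_)
open import Function.Definitions using (Injective)

iter : {A : Set} → (A → A) → ℕ → A → A
iter f zero a = a
iter f (suc k) a = f (iter f k a)

-- Convention: par root ≡ root (p(root) is not used by the paper).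
record RootedTree (n : ℕ) : Set where
  field
    root : Fin n
    par : Fin n → Fin n
    par-root : par root ≡ root
    reaches-root : ∀ v → ∃[ k ] iter par k v ≡ root

module TreeNotions {n : ℕ} (T : RootedTree n) where
  open RootedTree T

  IsChild : Fin n → Fin n → Set
  IsChild w v = w ≢ root × par w ≡ v

  NonLeaf : Fin n → Set
  NonLeaf v = ∃[ w ] IsChild w v

  Ancestor : Fin n → Fin n → Set
  Ancestor u v = ∃[ k ] iter par k v ≡ u

  StrictAncestor : Fin n → Fin n → Set
  StrictAncestor u v = Ancestor u v × u ≢ v

  ChainBelow : Fin n → List (Fin n) → Set
  ChainBelow s [] = ⊤
  ChainBelow s (w ∷ ws) = IsChild w s × ChainBelow w ws

  BranchFrom : Fin n → List (Fin n) → Set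
  BranchFrom s [] = ⊤
  BranchFrom s (w ∷ ws) = w ≡ s × ChainBelow w ws

LastBorn : {n : ℕ} (T : RootedTree n) → (Fin n → Fin n) → Fin n → Set
LastBorn T ℓ v = v ≢ RootedTree.root T × ℓ (RootedTree.par T v) ≡ v

-- Burling tree (T, r, ℓ, c).  ℓ is a total function but only its values on
-- non-leaf vertices are constrained (and used).  c v is given as a list of
-- vertices forming a branch; its vertex set is list membership.
record BurlingTree (n : ℕ) : Set where
  field
    tree : RootedTree n
    ℓ : Fin n → Fin n
    ℓ-child : ∀ v → TreeNotions.NonLeaf tree v → TreeNotions.IsChild tree (ℓ v) v
    c : Fin n → List (Fin n)
    c-branch : ∀ v → v ≢ RootedTree.root tree → ¬ LastBorn tree ℓ v →
               TreeNotions.BranchFrom tree (ℓ (RootedTree.par tree v)) (c v)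
    c-empty : ∀ v → (v ≡ RootedTree.root tree ⊎ LastBorn tree ℓ v) → c v ≡ []

module DerivedGraph {n : ℕ} (B : BurlingTree n) (S : Fin n → Set) where
  open BurlingTree B
  open TreeNotions tree

  -- arc uv of the fully derived oriented graph (G is its induced subgraph on S)
  Arc : Fin n → Fin n → Set
  Arc u v = v ∈ c u

  Adj : Fin n → Fin n → Set
  Adj u v = Arc u v ⊎ Arc v u

  CycNext : {k : ℕ} → Fin k → Fin k → Set
  CycNext {k} i j = toℕ j ≡ suc (toℕ i) ⊎ (suc (toℕ i) ≡ k × toℕ j ≡ 0)

  CycAdj : {k : ℕ} → Fin k → Fin k → Set
  CycAdj i j = CycNext i j ⊎ CycNext j i

  record Hole : Set where
    field
      len : ℕ
      len≥4 : 4 ≤ len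
      vtx : Fin len → Fin n
      vtx-inj : Injective _≡_ _≡_ vtx
      vtx-in-G : ∀ i → S (vtx i)
      induced : ∀ i j → Adj (vtx i) (vtx j) ⇔ CycAdj i j

  InH : Hole → Fin n → Set
  InH H v = ∃[ i ] Hole.vtx H i ≡ v

  HEdge : Hole → Fin n → Fin n → Set
  HEdge H u v = ∃[ i ] ∃[ j ] CycAdj i j × Hole.vtx H i ≡ u × Hole.vtx H j ≡ v

  InSH : Hole → Fin n → Set
  InSH H x = InH H x × (∀ u → StrictAncestor u x → ¬ InH H u)

  PivotData : Hole → Fin n → Fin n → Fin n → Set
  PivotData H p a a' =
    p ≢ a × p ≢ a' × a ≢ a' ×
    (∀ x → InSH H x ⇔ (x ≡ p ⊎ x ≡ a ⊎ x ≡ a')) ×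
    Arc a p × Arc a' p × ¬ Arc p a × ¬ Arc p a' × ¬ Arc a a' × ¬ Arc a' a

  IsPivot : Hole → Fin n → Set
  IsPivot H z = ∃[ a ] ∃[ a' ] PivotData H z a a'

  IsSubordinate : Hole → Fin n → Set
  IsSubordinate H z =
    InH H z × ∃[ p ] ∃[ a ] ∃[ a' ] (PivotData H p a a' × z ≢ p × z ≢ a × z ≢ a')

  record IsDomino (x y : Fin n) (H₁ H₂ : Hole) : Set where
    field
      edge-xy : Adj x y
      xy∈H₁ : HEdge H₁ x y
      xy∈H₂ : HEdge H₂ x y
      intersection : ∀ v → (InH H₁ v × InH H₂ v) ⇔ (v ≡ x ⊎ v ≡ y)
      cover : ∀ v → S v ⇔ (InH H₁ v ⊎ InH H₂ v)
      only-hole-edges : ∀ u v → S u → S v → Adj u v → HEdge H₁ u v ⊎ HEdge H₂ u v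

{-# OPTIONS --safe #-}
-- Every arc u → v of a Burling graph ends below ℓ (p u), the last-born sibling of u; hence
-- adjacent vertices are incomparable in T, and an edge leaving the subtree of a vertex s from
-- below s is an arc into s.  For a hole H this forces the shape of S_H: a vertex s of S_H with a
-- descendant in H is the pivot, its two cycle-neighbours are the antennas, and all other vertices
-- of H lie below s (if no vertex of H lay below another, the in-arcs at a shallowest vertex would
-- make a tail a last-born).  In a domino, the other hole can enter the subtree of a vertex lying
-- in one hole only through x or y.  So if neither x nor y were a pivot, one of them would be
-- subordinate in both holes, putting each pivot above the other; if x were the pivot of both
-- holes, the subordinate out-neighbours of the antenna y in the two holes would be comparable,
-- and the upper one would see the other hole inside its subtree; and if x is the pivot of one
-- hole and an antenna of the other, the edge xy is oriented both ways.
module Submission where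

open import Defs
open import Data.Nat using (ℕ; zero; suc; _+_; _∸_; _≤_; _<_; z≤n; s≤s; s≤s⁻¹)
open import Data.Nat.Properties hiding (_≟_)
open import Data.Fin using (Fin; toℕ; fromℕ<; _≟_)
open import Data.Fin.Properties using (toℕ-injective; toℕ<n; toℕ-fromℕ<; any?)
open import Data.Product using (Σ; ∃; ∃-syntax; _×_; _,_; proj₁; proj₂)
open import Data.Sum as Sum using (_⊎_; inj₁; inj₂)
open import Data.Empty using (⊥; ⊥-elim)
open import Induction.WellFounded using (Acc; acc)
open import Data.Nat.Induction using (<-wellFounded)
open import Function using (_∘_; _⇔_; Equivalence; mk⇔)
open import Relation.Nullary using (¬_; Dec; yes; no)
open import Relation.Nullary.Decidable using (_×-dec_; ¬?)
open import Data.List using (_∷_; allFin)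
open import Data.List.Extrema.Nat using (argmin; f[argmin]≤f[xs])
import Data.List.Relation.Unary.All as All
open import Data.List.Relation.Unary.Any using (here; there)
open import Data.List.Membership.Propositional using (_∈_)
open import Data.List.Membership.Propositional.Properties using (∉[]; ∈-allFin)
open import Relation.Binary.PropositionalEquality
  using (_≡_; _≢_; refl; sym; trans; cong; subst; ≢-sym; module ≡-Reasoning)

least-witness : (P : ℕ → Set) → (∀ k → Dec (P k)) → ∃ P →
                Σ ℕ λ m → P m × (∀ k → P k → m ≤ k)
least-witness P P? (K , pK) = search 0 K refl (λ _ ())
  where
  search : ∀ i f → i + f ≡ K → (∀ k → k < i → ¬ P k) →
           Σ ℕ λ m → P m × (∀ k → P k → m ≤ k)
  search i zero i+0≡K below =
    i , subst P (sym (trans (sym (+-identityʳ i)) i+0≡K)) pK , λ k pk → ≮⇒≥ (λ k<i → below k k<i pk)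
  search i (suc f) i+f≡K below with P? i
  ... | yes pi = i , pi , λ k pk → ≮⇒≥ (λ k<i → below k k<i pk)
  ... | no ¬pi = search (suc i) f (trans (sym (+-suc i f)) i+f≡K) below′
    where
    below′ : ∀ k → k < suc i → ¬ P k
    below′ k k<1+i with m≤n⇒m<n∨m≡n (s≤s⁻¹ k<1+i)
    ... | inj₁ k<i = below k k<i
    ... | inj₂ refl = ¬pi

module Ancestry {n : ℕ} (T : RootedTree n) where
  open RootedTree T
  open TreeNotions T

  iter-+ : ∀ j k v → iter par (j + k) v ≡ iter par j (iter par k v)
  iter-+ zero k v = refl
  iter-+ (suc j) k v = cong par (iter-+ j k v)

  iter-suc : ∀ k v → iter par (suc k) v ≡ iter par k (par v)
  iter-suc k v = trans (cong (λ m → iter par m v) (+-comm 1 k)) (iter-+ k 1 v)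

  iter-root : ∀ k → iter par k root ≡ root
  iter-root zero = refl
  iter-root (suc k) = trans (cong par (iter-root k)) par-root

  private
    depth-witness : ∀ v → Σ ℕ λ m → iter par m v ≡ root × (∀ k → iter par k v ≡ root → m ≤ k)
    depth-witness v = least-witness (λ k → iter par k v ≡ root) (λ k → iter par k v ≟ root) (reaches-root v)

  depth : Fin n → ℕ
  depth v = proj₁ (depth-witness v)

  iter-depth : ∀ v → iter par (depth v) v ≡ root
  iter-depth v = proj₁ (proj₂ (depth-witness v))

  depth-minimal : ∀ v k → iter par k v ≡ root → depth v ≤ k
  depth-minimal v = proj₂ (proj₂ (depth-witness v))

  iter-beyond-depth : ∀ v k → depth v ≤ k → iter par k v ≡ root
  iter-beyond-depth v k d≤k = begin
    iter par k v                          ≡⟨ cong (λ m → iter par m v) (sym (m∸n+n≡m d≤k)) ⟩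
    iter par (k ∸ depth v + depth v) v    ≡⟨ iter-+ (k ∸ depth v) (depth v) v ⟩
    iter par (k ∸ depth v) (iter par (depth v) v) ≡⟨ cong (iter par (k ∸ depth v)) (iter-depth v) ⟩
    iter par (k ∸ depth v) root           ≡⟨ iter-root (k ∸ depth v) ⟩
    root                                  ∎
    where open ≡-Reasoning

  depth-par : ∀ v → v ≢ root → depth v ≡ suc (depth (par v))
  depth-par v v≢root with depth v in eq | iter-depth v | depth-minimal v
  ... | zero  | iter≡root | _   = ⊥-elim (v≢root iter≡root)
  ... | suc d | iter≡root | min = cong suc (≤-antisym d≤ ≤d)
    where
    ≤d : depth (par v) ≤ d
    ≤d = depth-minimal (par v) d (trans (sym (iter-suc d v)) iter≡root)
    d≤ : d ≤ depth (par v)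
    d≤ = s≤s⁻¹ (min (suc (depth (par v))) (trans (iter-suc (depth (par v)) v) (iter-depth (par v))))

  ancestor-refl : ∀ v → Ancestor v v
  ancestor-refl v = 0 , refl

  ancestor-par : ∀ v → Ancestor (par v) v
  ancestor-par v = 1 , refl

  ancestor-trans : ∀ {u v w} → Ancestor u v → Ancestor v w → Ancestor u w
  ancestor-trans {w = w} (j , refl) (k , refl) = j + k , iter-+ j k w

  child⇒ancestor : ∀ {w v} → IsChild w v → Ancestor v w
  child⇒ancestor (_ , par-w≡v) = 1 , par-w≡v

  child-depth : ∀ {w v} → IsChild w v → depth w ≡ suc (depth v)
  child-depth (w≢root , refl) = depth-par _ w≢root

  ancestor-of-root : ∀ {u} → Ancestor u root → u ≡ root
  ancestor-of-root (k , refl) = iter-root k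

  strict-ancestor⇒ancestor-par : ∀ {u v} → Ancestor u v → u ≢ v → Ancestor u (par v)
  strict-ancestor⇒ancestor-par (zero , u≡v) u≢v = ⊥-elim (u≢v (sym u≡v))
  strict-ancestor⇒ancestor-par {v = v} (suc k , eq) _ = k , trans (sym (iter-suc k v)) eq

  ancestor⇒depth-≤ : ∀ {u v} → Ancestor u v → depth u ≤ depth v
  ancestor⇒depth-≤ {v = v} (k , refl) = go k
    where
    depth-par-≤ : ∀ w → depth (par w) ≤ depth w
    depth-par-≤ w with w ≟ root
    ... | yes refl = ≤-reflexive (cong depth par-root)
    ... | no w≢root = ≤-trans (n≤1+n _) (≤-reflexive (sym (depth-par w w≢root)))
    go : ∀ k → depth (iter par k v) ≤ depth v
    go zero = ≤-refl
    go (suc k) = ≤-trans (depth-par-≤ _) (go k)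

  strict-ancestor⇒depth-< : ∀ {u v} → Ancestor u v → u ≢ v → depth u < depth v
  strict-ancestor⇒depth-< {u} {v} u≤v u≢v with v ≟ root
  ... | yes refl = ⊥-elim (u≢v (ancestor-of-root u≤v))
  ... | no v≢root = subst (depth u <_) (sym (depth-par v v≢root))
                      (s≤s (ancestor⇒depth-≤ (strict-ancestor⇒ancestor-par u≤v u≢v)))

  ancestor-depth-≡⇒≡ : ∀ {u v} → Ancestor u v → depth u ≡ depth v → u ≡ v
  ancestor-depth-≡⇒≡ {u} {v} u≤v d≡ with u ≟ v
  ... | yes u≡v = u≡v
  ... | no u≢v = ⊥-elim (<-irrefl d≡ (strict-ancestor⇒depth-< u≤v u≢v))

  ancestor-antisym : ∀ {u v} → Ancestor u v → Ancestor v u → u ≡ v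
  ancestor-antisym u≤v v≤u =
    ancestor-depth-≡⇒≡ u≤v (≤-antisym (ancestor⇒depth-≤ u≤v) (ancestor⇒depth-≤ v≤u))

  ancestors-comparable : ∀ {u v w} → Ancestor u w → Ancestor v w → Ancestor u v ⊎ Ancestor v u
  ancestors-comparable {w = w} (j , refl) (k , refl) with ≤-total j k
  ... | inj₁ j≤k = inj₂ (k ∸ j , trans (sym (iter-+ (k ∸ j) j w)) (cong (λ m → iter par m w) (m∸n+n≡m j≤k)))
  ... | inj₂ k≤j = inj₁ (j ∸ k , trans (sym (iter-+ (j ∸ k) k w)) (cong (λ m → iter par m w) (m∸n+n≡m k≤j)))

  between-parent-and-child : ∀ {w b s} → IsChild w b → Ancestor b s → b ≢ s → Ancestor s w → s ≡ w
  between-parent-and-child w-child b≤s b≢s s≤w = ancestor-depth-≡⇒≡ s≤w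
    (≤-antisym (ancestor⇒depth-≤ s≤w) (subst (_≤ _) (sym (child-depth w-child)) (strict-ancestor⇒depth-< b≤s b≢s)))

  comparable-depth-≡⇒≡ : ∀ {u v} → Ancestor u v ⊎ Ancestor v u → depth u ≡ depth v → u ≡ v
  comparable-depth-≡⇒≡ (inj₁ u≤v) d≡ = ancestor-depth-≡⇒≡ u≤v d≡
  comparable-depth-≡⇒≡ (inj₂ v≤u) d≡ = sym (ancestor-depth-≡⇒≡ v≤u (sym d≡))

  -- Only the first depth v + 1 iterates can differ from the root.
  ancestor? : ∀ u v → Dec (Ancestor u v)
  ancestor? u v with any? (λ (k : Fin (suc (depth v))) → iter par (toℕ k) v ≟ u)
  ... | yes (k , eq) = yes (toℕ k , eq)
  ... | no ¬bounded = no λ (k , eq) → ¬bounded (bounded k eq)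
    where
    bounded : ∀ k → iter par k v ≡ u → ∃[ i ] iter par (toℕ {suc (depth v)} i) v ≡ u
    bounded k eq with k ≤? depth v
    ... | yes k≤d = fromℕ< (s≤s k≤d) , trans (cong (λ m → iter par m v) (toℕ-fromℕ< (s≤s k≤d))) eq
    ... | no k≰d = fromℕ< (n<1+n (depth v)) ,
          trans (cong (λ m → iter par m v) (toℕ-fromℕ< (n<1+n (depth v))))
                (trans (iter-depth v) (trans (sym (iter-beyond-depth v k (<⇒≤ (≰⇒> k≰d)))) eq))

module BurlingArcs {n : ℕ} (B : BurlingTree n) where
  open BurlingTree B
  open RootedTree tree
  open TreeNotions tree
  open Ancestry tree

  -- Arc and Adj agree definitionally with those of DerivedGraph B S, for every S.
  Arc : Fin n → Fin n → Set
  Arc u v = v ∈ c u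

  Adj : Fin n → Fin n → Set
  Adj u v = Arc u v ⊎ Arc v u

  chain-below : ∀ {s ws v} → ChainBelow s ws → v ∈ ws → Ancestor s (par v)
  chain-below {ws = w ∷ _} ((_ , par-w≡s) , _) (here refl) = 0 , par-w≡s
  chain-below {ws = w ∷ _} (w-child , chain) (there v∈ws) =
    ancestor-trans (child⇒ancestor w-child) (chain-below chain v∈ws)

  branch-below : ∀ {b L v} → BranchFrom b L → v ∈ L → Ancestor b v
  branch-below {L = _ ∷ _} (refl , _) (here refl) = ancestor-refl _
  branch-below {L = _ ∷ _} (refl , chain) (there v∈L) = ancestor-trans (chain-below chain v∈L) (ancestor-par _)

  branch-convex : ∀ {b L v s} → BranchFrom b L → v ∈ L → Ancestor b s → Ancestor s v → s ∈ L
  branch-convex {b} {_ ∷ ws} {s = s} (refl , chain) v∈L b≤s s≤v with s ≟ b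
  ... | yes refl = here refl
  ... | no s≢b = there (in-tail ws chain v∈L)
    where
    in-tail : ∀ ws → ChainBelow b ws → _ ∈ b ∷ ws → s ∈ ws
    in-tail _ _ (here refl) = ⊥-elim (s≢b (ancestor-antisym s≤v b≤s))
    in-tail (w ∷ _) (w-child , chain) (there v∈ws) = branch-convex (refl , chain) v∈ws w≤s s≤v
      where
      w≤s : Ancestor w s
      w≤s with ancestors-comparable (branch-below (refl , chain) v∈ws) s≤v
      ... | inj₁ w≤s = w≤s
      ... | inj₂ s≤w = subst (λ t → Ancestor t s) (between-parent-and-child w-child b≤s (≢-sym s≢b) s≤w)
                             (ancestor-refl s)

  branch-comparable : ∀ {b L u v} → BranchFrom b L → u ∈ L → v ∈ L → Ancestor u v ⊎ Ancestor v u
  branch-comparable {L = _ ∷ _} br@(refl , _) (here refl) v∈L = inj₁ (branch-below br v∈L)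
  branch-comparable {L = _ ∷ _} br@(refl , _) (there u∈L) (here refl) = inj₂ (branch-below br (there u∈L))
  branch-comparable {L = _ ∷ w ∷ _} (refl , (_ , chain)) (there u∈L) (there v∈L) =
    branch-comparable {L = w ∷ _} (refl , chain) u∈L v∈L

  private
    arc-tail-ok : ∀ {u v} → Arc u v → u ≢ root × ℓ (par u) ≢ u
    arc-tail-ok {u} {v} v∈cu with u ≟ root | ℓ (par u) ≟ u
    ... | yes u≡root | _ = ⊥-elim (∉[] (subst (v ∈_) (c-empty u (inj₁ u≡root)) v∈cu))
    ... | no u≢root | yes lb = ⊥-elim (∉[] (subst (v ∈_) (c-empty u (inj₂ (u≢root , lb))) v∈cu))
    ... | no u≢root | no ¬lb = u≢root , ¬lb

  arc-tail≢root : ∀ {u v} → Arc u v → u ≢ root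
  arc-tail≢root a = proj₁ (arc-tail-ok a)

  arc-tail-not-lastBorn : ∀ {u v} → Arc u v → ℓ (par u) ≢ u
  arc-tail-not-lastBorn a = proj₂ (arc-tail-ok a)

  arc-branch : ∀ {u v} → Arc u v → BranchFrom (ℓ (par u)) (c u)
  arc-branch {u} a = c-branch u (arc-tail≢root a) (λ (_ , lb) → arc-tail-not-lastBorn a lb)

  ℓ-par-child : ∀ u → u ≢ root → IsChild (ℓ (par u)) (par u)
  ℓ-par-child u u≢root = ℓ-child (par u) (u , u≢root , refl)

  depth-ℓ-par : ∀ u → u ≢ root → depth (ℓ (par u)) ≡ depth u
  depth-ℓ-par u u≢root = trans (child-depth (ℓ-par-child u u≢root)) (sym (depth-par u u≢root))

  ℓ-par-above-head : ∀ {u v} → Arc u v → Ancestor (ℓ (par u)) v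
  ℓ-par-above-head a = branch-below (arc-branch a) a

  arc-head≢root : ∀ {u v} → Arc u v → v ≢ root
  arc-head≢root {u} a refl = proj₁ (ℓ-par-child u (arc-tail≢root a)) (ancestor-of-root (ℓ-par-above-head a))

  arc-depth-≤ : ∀ {u v} → Arc u v → depth u ≤ depth v
  arc-depth-≤ {u} a =
    subst (_≤ _) (depth-ℓ-par u (arc-tail≢root a)) (ancestor⇒depth-≤ (ℓ-par-above-head a))

  arc-to-shallower⇒lastBorn : ∀ {u v} → Arc u v → depth v ≤ depth u → ℓ (par v) ≡ v
  arc-to-shallower⇒lastBorn {u} {v} a dv≤du = begin
    ℓ (par v)          ≡⟨ cong (ℓ ∘ par) (sym ℓ-par-u≡v) ⟩
    ℓ (par (ℓ (par u))) ≡⟨ cong ℓ (proj₂ (ℓ-par-child u (arc-tail≢root a))) ⟩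
    ℓ (par u)          ≡⟨ ℓ-par-u≡v ⟩
    v                  ∎
    where
    open ≡-Reasoning
    ℓ-par-u≡v : ℓ (par u) ≡ v
    ℓ-par-u≡v = ancestor-depth-≡⇒≡ (ℓ-par-above-head a)
                  (trans (depth-ℓ-par u (arc-tail≢root a)) (≤-antisym (arc-depth-≤ a) dv≤du))

  arc-asym : ∀ {u v} → Arc u v → ¬ Arc v u
  arc-asym uv vu = arc-tail-not-lastBorn vu (arc-to-shallower⇒lastBorn uv (arc-depth-≤ vu))

  adj-sym : ∀ {u v} → Adj u v → Adj v u
  adj-sym (inj₁ a) = inj₂ a
  adj-sym (inj₂ a) = inj₁ a

  adj⇒¬ancestor : ∀ {u v} → Adj u v → ¬ Ancestor u v
  adj⇒¬ancestor {u} (inj₁ a) u≤v = arc-tail-not-lastBorn a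
    (comparable-depth-≡⇒≡ (ancestors-comparable (ℓ-par-above-head a) u≤v)
                          (depth-ℓ-par u (arc-tail≢root a)))
  adj⇒¬ancestor {v = v} (inj₂ a) u≤v = arc-tail-not-lastBorn a
    (ancestor-depth-≡⇒≡ (ancestor-trans (ℓ-par-above-head a) u≤v) (depth-ℓ-par v (arc-tail≢root a)))

  adj-irrefl : ∀ {u v} → Adj u v → u ≢ v
  adj-irrefl a refl = adj⇒¬ancestor a (ancestor-refl _)

  adj⇒≢root : ∀ {u v} → Adj u v → u ≢ root
  adj⇒≢root (inj₁ a) = arc-tail≢root a
  adj⇒≢root (inj₂ a) = arc-head≢root a

  arc-heads-comparable : ∀ {u v w} → Arc u v → Arc u w → Ancestor v w ⊎ Ancestor w v
  arc-heads-comparable uv uw = branch-comparable (arc-branch uv) uv uw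

  -- In the second case the branch c v runs down from ℓ (par v) through s to u.
  adj-leaving-subtree : ∀ {s u v} → Adj u v → Ancestor s u → ¬ Ancestor s v →
                        u ≡ s ⊎ (Arc v s × Arc v u)
  adj-leaving-subtree {s} {u} (inj₁ a) s≤u s≰v with u ≟ s
  ... | yes u≡s = inj₁ u≡s
  ... | no u≢s = ⊥-elim (s≰v (ancestor-trans (strict-ancestor⇒ancestor-par s≤u (≢-sym u≢s))
                   (ancestor-trans (child⇒ancestor (ℓ-par-child u (arc-tail≢root a))) (ℓ-par-above-head a))))
  adj-leaving-subtree {s} {v = v} (inj₂ a) s≤u s≰v with s ≟ ℓ (par v)
  ... | yes refl = inj₂ (branch-convex (arc-branch a) a (ancestor-refl s) s≤u , a)
  ... | no s≢ℓ with ancestors-comparable (ℓ-par-above-head a) s≤u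
  ... | inj₁ ℓ≤s = inj₂ (branch-convex (arc-branch a) a ℓ≤s s≤u , a)
  ... | inj₂ s≤ℓ = ⊥-elim (s≰v (ancestor-trans (strict-ancestor⇒ancestor-par s≤ℓ s≢ℓ)
                   (subst (λ t → Ancestor t v) (sym (proj₂ (ℓ-par-child v (arc-tail≢root a))))
                          (ancestor-par v))))

module Cyclic (L : ℕ) (3≤L : 3 ≤ L) where

  -- Next and Neighbour unfold to DerivedGraph.CycNext and DerivedGraph.CycAdj.
  Next : Fin L → Fin L → Set
  Next i j = toℕ j ≡ suc (toℕ i) ⊎ (suc (toℕ i) ≡ L × toℕ j ≡ 0)

  Neighbour : Fin L → Fin L → Set
  Neighbour i j = Next i j ⊎ Next j i

  private
    0<L : 0 < L
    0<L = ≤-trans (s≤s z≤n) 3≤L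

    L≢1 : L ≢ 1
    L≢1 L≡1 = <⇒≢ (≤-trans (s≤s (s≤s z≤n)) 3≤L) (sym L≡1)

    L≢2 : L ≢ 2
    L≢2 L≡2 = <⇒≢ 3≤L (sym L≡2)

    predecessor : ∀ {m} → 0 < m → ∃[ k ] suc k ≡ m
    predecessor (s≤s _) = _ , refl

  first : Fin L
  first = fromℕ< 0<L

  last : Fin L
  last = fromℕ< (≤-reflexive (proj₂ (predecessor 0<L)))

  private
    next-with-spec : ∀ i → Σ (Fin L) (Next i)
    next-with-spec i with suc (toℕ i) <? L
    ... | yes i+1<L = fromℕ< i+1<L , inj₁ (toℕ-fromℕ< i+1<L)
    ... | no i+1≮L = first , inj₂ (≤-antisym (toℕ<n i) (≮⇒≥ i+1≮L) , toℕ-fromℕ< 0<L)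

    prev-with-spec : ∀ i → Σ (Fin L) (λ j → Next j i)
    prev-with-spec i with toℕ i in eq
    ... | zero = last , inj₂ (trans (cong suc (toℕ-fromℕ< _)) (proj₂ (predecessor 0<L)) , refl)
    ... | suc k = fromℕ< k<L , inj₁ (cong suc (sym (toℕ-fromℕ< k<L)))
      where
      k<L : k < L
      k<L = <-trans (n<1+n k) (subst (_< L) eq (toℕ<n i))

  next : Fin L → Fin L
  next i = proj₁ (next-with-spec i)

  Next-next : ∀ i → Next i (next i)
  Next-next i = proj₂ (next-with-spec i)

  prev : Fin L → Fin L
  prev i = proj₁ (prev-with-spec i)

  Next-prev : ∀ i → Next (prev i) i
  Next-prev i = proj₂ (prev-with-spec i)

  Next-functional : ∀ {i j k} → Next i j → Next i k → j ≡ k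
  Next-functional (inj₁ j≡) (inj₁ k≡) = toℕ-injective (trans j≡ (sym k≡))
  Next-functional {j = j} (inj₁ j≡) (inj₂ (i+1≡L , _)) = ⊥-elim (<-irrefl (trans j≡ i+1≡L) (toℕ<n j))
  Next-functional {k = k} (inj₂ (i+1≡L , _)) (inj₁ k≡) = ⊥-elim (<-irrefl (trans k≡ i+1≡L) (toℕ<n k))
  Next-functional (inj₂ (_ , j≡0)) (inj₂ (_ , k≡0)) = toℕ-injective (trans j≡0 (sym k≡0))

  Next-injective : ∀ {i j k} → Next i k → Next j k → i ≡ j
  Next-injective (inj₁ k≡i+1) (inj₁ k≡j+1) = toℕ-injective (suc-injective (trans (sym k≡i+1) k≡j+1))
  Next-injective (inj₁ k≡i+1) (inj₂ (_ , k≡0)) with trans (sym k≡i+1) k≡0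
  ... | ()
  Next-injective (inj₂ (_ , k≡0)) (inj₁ k≡j+1) with trans (sym k≡j+1) k≡0
  ... | ()
  Next-injective (inj₂ (i+1≡L , _)) (inj₂ (j+1≡L , _)) =
    toℕ-injective (suc-injective (trans i+1≡L (sym j+1≡L)))

  Next-irrefl : ∀ {i} → ¬ Next i i
  Next-irrefl (inj₁ i≡i+1) = <-irrefl i≡i+1 (n<1+n _)
  Next-irrefl (inj₂ (i+1≡L , i≡0)) = L≢1 (trans (sym i+1≡L) (cong suc i≡0))

  Next-asym : ∀ {i j} → Next i j → ¬ Next j i
  Next-asym (inj₁ j≡i+1) (inj₁ i≡j+1) = <-irrefl (trans i≡j+1 (cong suc j≡i+1)) (m<n⇒m<1+n (n<1+n _))
  Next-asym (inj₁ j≡i+1) (inj₂ (j+1≡L , i≡0)) =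
    L≢2 (trans (sym j+1≡L) (cong suc (trans j≡i+1 (cong suc i≡0))))
  Next-asym (inj₂ (i+1≡L , j≡0)) (inj₁ i≡j+1) =
    L≢2 (trans (sym i+1≡L) (cong suc (trans i≡j+1 (cong suc j≡0))))
  Next-asym (inj₂ (i+1≡L , j≡0)) (inj₂ (_ , i≡0)) = L≢1 (trans (sym i+1≡L) (cong suc i≡0))

  next-injective : ∀ {i j} → next i ≡ next j → i ≡ j
  next-injective {i} {j} eq = Next-injective (Next-next i) (subst (Next j) (sym eq) (Next-next j))

  next≢prev : ∀ i → next i ≢ prev i
  next≢prev i eq = Next-asym (Next-next i) (subst (λ j → Next j i) (sym eq) (Next-prev i))

  next-next≢ : ∀ i → next (next i) ≢ i
  next-next≢ i eq = Next-asym (Next-next i) (subst (Next (next i)) eq (Next-next (next i)))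

  prev-prev≢ : ∀ i → prev (prev i) ≢ i
  prev-prev≢ i eq = Next-asym (subst (λ j → Next j (prev i)) eq (Next-prev (prev i))) (Next-prev i)

  Neighbour-irrefl : ∀ {i} → ¬ Neighbour i i
  Neighbour-irrefl (inj₁ n) = Next-irrefl n
  Neighbour-irrefl (inj₂ n) = Next-irrefl n

  Neighbour-sym : ∀ {i j} → Neighbour i j → Neighbour j i
  Neighbour-sym (inj₁ n) = inj₂ n
  Neighbour-sym (inj₂ n) = inj₁ n

  Neighbour-next : ∀ i → Neighbour i (next i)
  Neighbour-next i = inj₁ (Next-next i)

  Neighbour-prev : ∀ i → Neighbour i (prev i)
  Neighbour-prev i = inj₂ (Next-prev i)

  neighbours : ∀ {i j} → Neighbour i j → j ≡ next i ⊎ j ≡ prev i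
  neighbours {i} (inj₁ n) = inj₁ (Next-functional n (Next-next i))
  neighbours {i} (inj₂ n) = inj₂ (Next-injective n (Next-prev i))

  only-two-neighbours : ∀ {i j k} → Neighbour i j → Neighbour i k → j ≢ k →
                        ∀ m → Neighbour i m → m ≡ j ⊎ m ≡ k
  only-two-neighbours ij ik j≢k m im with neighbours ij | neighbours ik | neighbours im
  ... | inj₁ refl | inj₁ refl | _ = ⊥-elim (j≢k refl)
  ... | inj₂ refl | inj₂ refl | _ = ⊥-elim (j≢k refl)
  ... | inj₁ refl | inj₂ refl | inj₁ refl = inj₁ refl
  ... | inj₁ refl | inj₂ refl | inj₂ refl = inj₂ refl
  ... | inj₂ refl | inj₁ refl | inj₁ refl = inj₂ refl
  ... | inj₂ refl | inj₁ refl | inj₂ refl = inj₁ refl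

  closed-under-next : (Q : Fin L → Set) → (∀ i → Q i → Q (next i)) → ∀ {a} → Q a → ∀ b → Q b
  closed-under-next Q Q-next {a} qa b =
    subst Q (toℕ-injective (trans (toℕ-fromℕ< first+b<L) (cong (_+ toℕ b) (toℕ-fromℕ< 0<L))))
          (forward q-first (toℕ b) first+b<L)
    where
    forward : ∀ {a} → Q a → ∀ d (p : toℕ a + d < L) → Q (fromℕ< p)
    forward qa zero p = subst Q (sym (toℕ-injective (trans (toℕ-fromℕ< p) (+-identityʳ _)))) qa
    forward {a} qa (suc d) p = subst Q (Next-functional (Next-next _) step) (Q-next _ (forward qa d p′))
      where
      p′ : toℕ a + d < L
      p′ = <-trans (n<1+n _) (subst (_< L) (+-suc (toℕ a) d) p)
      step : Next (fromℕ< p′) (fromℕ< p)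
      step = inj₁ (trans (toℕ-fromℕ< p) (trans (+-suc (toℕ a) d) (cong suc (sym (toℕ-fromℕ< p′)))))
    a+rest≡L : suc (toℕ a + (L ∸ suc (toℕ a))) ≡ L
    a+rest≡L = m+[n∸m]≡n (toℕ<n a)
    q-first : Q first
    q-first = subst Q (Next-functional (Next-next _) wrap) (Q-next _ (forward qa _ (≤-reflexive a+rest≡L)))
      where
      wrap : Next (fromℕ< (≤-reflexive a+rest≡L)) first
      wrap = inj₂ (trans (cong suc (toℕ-fromℕ< _)) a+rest≡L , toℕ-fromℕ< 0<L)
    first+b<L : toℕ first + toℕ b < L
    first+b<L = subst (λ m → m + toℕ b < L) (sym (toℕ-fromℕ< 0<L)) (toℕ<n b)

  crossing : (Q : Fin L → Set) → (∀ i → Dec (Q i)) → ∀ {a b} → Q a → ¬ Q b →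
             ∃[ i ] Q i × ¬ Q (next i)
  crossing Q Q? {a} {b} qa ¬qb with any? (λ i → Q? i ×-dec ¬? (Q? (next i)))
  ... | yes found = found
  ... | no none = ⊥-elim (¬qb (closed-under-next Q Q-next qa b))
    where
    Q-next : ∀ i → Q i → Q (next i)
    Q-next i qi with Q? (next i)
    ... | yes q = q
    ... | no ¬q = ⊥-elim (none (i , qi , ¬q))

module HolePivot {n : ℕ} (B : BurlingTree n) (S : Fin n → Set) where
  open BurlingTree B
  open RootedTree tree
  open TreeNotions tree
  open Ancestry tree
  open BurlingArcs B
  open DerivedGraph B S using (Hole; InH; InSH; PivotData)

  record PivotStructure (H : Hole) (p a a′ : Fin n) : Set where
    field
      pivotData : PivotData H p a a′
      below-or-antenna : ∀ v → InH H v → Ancestor p v ⊎ v ≡ a ⊎ v ≡ a′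
      pivot-neighbours : ∀ v → InH H v → Adj p v → v ≡ a ⊎ v ≡ a′

  module OnHole (H : Hole) where
    open Hole H
    open Cyclic len (≤-trans (n≤1+n 3) len≥4)

    Neighbour⇒adj : ∀ {i j} → Neighbour i j → Adj (vtx i) (vtx j)
    Neighbour⇒adj {i} {j} = Equivalence.from (induced i j)

    adj⇒Neighbour : ∀ {i j} → Adj (vtx i) (vtx j) → Neighbour i j
    adj⇒Neighbour {i} {j} = Equivalence.to (induced i j)

    -- Some forward edge i → next i leaves P, so next i is the index of z.  Walking forward from
    -- a vertex outside P ∪ {z}, the first step into P ∪ {z} can enter neither P (that edge would
    -- leave P backwards at a vertex other than z) nor z (whose predecessor i lies in P).
    no-separating-vertex : (P : Fin n → Set) → (∀ v → Dec (P v)) → (z : Fin n) →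
      (∀ i j → Neighbour i j → P (vtx i) → ¬ P (vtx j) → vtx j ≡ z) →
      ∃[ i ] P (vtx i) → ¬ (∃[ i ] ¬ P (vtx i) × vtx i ≢ z)
    no-separating-vertex P P? z exits-at-z (a , pa) (b , ¬pb , b≢z) with
      crossing (λ i → P (vtx i)) (λ i → P? (vtx i)) pa ¬pb
    ... | i , pi , ¬p-next-i with crossing R R? (¬pb , b≢z) (λ (¬pi , _) → ¬pi pi)
      where
      R : Fin len → Set
      R k = ¬ P (vtx k) × vtx k ≢ z
      R? : ∀ k → Dec (R k)
      R? k = ¬? (P? (vtx k)) ×-dec ¬? (vtx k ≟ z)
    ... | k , (¬pk , k≢z) , ¬r-next-k with P? (vtx (next k)) | vtx (next k) ≟ z
    ...   | yes p-next-k | _ = k≢z (exits-at-z (next k) k (Neighbour-sym (Neighbour-next k)) p-next-k ¬pk)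
    ...   | no ¬p-next-k | no next-k≢z = ¬r-next-k (¬p-next-k , next-k≢z)
    ...   | no _ | yes next-k≡z = ¬pk (subst (P ∘ vtx) (next-injective (vtx-inj
              (trans (exits-at-z i (next i) (Neighbour-next i) pi ¬p-next-i) (sym next-k≡z)))) pi)

    other-neighbour : ∀ {v} → InH H v → ∀ u → ∃[ w ] InH H w × Adj v w × w ≢ u
    other-neighbour (i , refl) u with vtx (next i) ≟ u
    ... | no next≢u = vtx (next i) , (next i , refl) , Neighbour⇒adj (Neighbour-next i) , next≢u
    ... | yes next≡u = vtx (prev i) , (prev i , refl) , Neighbour⇒adj (Neighbour-prev i) ,
                       λ prev≡u → next≢prev i (vtx-inj (trans next≡u (sym prev≡u)))

    HasStrictAncestorInH : Fin n → Set
    HasStrictAncestorInH v = ∃[ i ] StrictAncestor (vtx i) v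

    hasStrictAncestorInH? : ∀ v → Dec (HasStrictAncestorInH v)
    hasStrictAncestorInH? v = any? (λ i → ancestor? (vtx i) v ×-dec ¬? (vtx i ≟ v))

    ¬hasStrictAncestorInH⇒InSH : ∀ {v} → InH H v → ¬ HasStrictAncestorInH v → InSH H v
    ¬hasStrictAncestorInH⇒InSH v∈H none = v∈H , λ { u u<v (i , refl) → none (i , u<v) }

    InSH-ancestor : ∀ {v} → InH H v → ∃[ t ] Ancestor t v × InSH H t
    InSH-ancestor {v} v∈H = go v (<-wellFounded (depth v)) v∈H
      where
      go : ∀ v → Acc _<_ (depth v) → InH H v → ∃[ t ] Ancestor t v × InSH H t
      go v (acc below) v∈H with hasStrictAncestorInH? v
      ... | no none = v , ancestor-refl v , ¬hasStrictAncestorInH⇒InSH v∈H none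
      ... | yes (i , i≤v , i≢v) with go (vtx i) (below (strict-ancestor⇒depth-< i≤v i≢v)) (i , refl)
      ...   | t , t≤i , t∈SH = t , ancestor-trans t≤i i≤v , t∈SH

    module PivotFromDescendant (is : Fin len) (s∈SH : InSH H (vtx is))
                             (iu : Fin len) (s≤u : Ancestor (vtx is) (vtx iu)) (s≢u : vtx is ≢ vtx iu) where
      private
        s a a′ : Fin n
        s = vtx is
        a = vtx (next is)
        a′ = vtx (prev is)

      Below : Fin n → Set
      Below v = Ancestor s v × v ≢ s

      -- The only edges leaving the subtree of s are arcs into s from its two cycle-neighbours,
      -- so walking away from s past a neighbour we re-enter the subtree at once.
      beyond-neighbour-below : ∀ {k k₀} → Neighbour is k → Neighbour is k₀ → k ≢ k₀ →
                               ∀ {k′} → Neighbour k k′ → k′ ≢ is → Ancestor s (vtx k′)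
      beyond-neighbour-below {k} {k₀} is-k is-k₀ k≢k₀ {k′} k-k′ k′≢is with ancestor? s (vtx k′)
      ... | yes s≤k′ = s≤k′
      ... | no s≰k′ = ⊥-elim (no-separating-vertex Below below? (vtx k₀) exits
                        (iu , s≤u , λ u≡s → s≢u (sym u≡s))
                        (is , (λ (_ , s≢s) → s≢s refl) ,
                         λ s≡k₀ → Neighbour-irrefl (subst (Neighbour is) (sym (vtx-inj s≡k₀)) is-k₀)))
        where
        below? : ∀ v → Dec (Below v)
        below? v = ancestor? s v ×-dec ¬? (v ≟ s)
        exits : ∀ i j → Neighbour i j → Below (vtx i) → ¬ Below (vtx j) → vtx j ≡ vtx k₀
        exits i j i-j (s≤i , i≢s) ¬below-j with vtx j ≟ s
        ... | yes j≡s = ⊥-elim (adj⇒¬ancestor (adj-sym (subst (Adj (vtx i)) j≡s (Neighbour⇒adj i-j))) s≤i)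
        ... | no j≢s with adj-leaving-subtree (Neighbour⇒adj i-j) s≤i (λ s≤j → ¬below-j (s≤j , j≢s))
        ...   | inj₁ i≡s = ⊥-elim (i≢s i≡s)
        ...   | inj₂ (j→s , _)
                with only-two-neighbours is-k is-k₀ k≢k₀ j (adj⇒Neighbour {is} {j} (inj₂ j→s))
        ...     | inj₂ refl = refl
        ...     | inj₁ refl
                with only-two-neighbours (Neighbour-sym is-k) k-k′ (≢-sym k′≢is) i (Neighbour-sym i-j)
        ...       | inj₁ refl = ⊥-elim (i≢s refl)
        ...       | inj₂ refl = ⊥-elim (s≰k′ s≤i)

      below-after-a : Ancestor s (vtx (next (next is)))
      below-after-a = beyond-neighbour-below (Neighbour-next is) (Neighbour-prev is) (next≢prev is)
                        (Neighbour-next (next is)) (next-next≢ is)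

      below-before-a′ : Ancestor s (vtx (prev (prev is)))
      below-before-a′ = beyond-neighbour-below (Neighbour-prev is) (Neighbour-next is) (≢-sym (next≢prev is))
                          (Neighbour-prev (prev is)) (prev-prev≢ is)

      antenna-arc : ∀ {k k′} → Neighbour is k → Neighbour k′ k → k′ ≢ is → Ancestor s (vtx k′) →
                    Arc (vtx k) s
      antenna-arc is-k k′-k k′≢is s≤k′
        with adj-leaving-subtree (Neighbour⇒adj k′-k) s≤k′ (adj⇒¬ancestor (Neighbour⇒adj is-k))
      ... | inj₁ k′≡s = ⊥-elim (k′≢is (vtx-inj k′≡s))
      ... | inj₂ (k→s , _) = k→s

      a→s : Arc a s
      a→s = antenna-arc (Neighbour-next is) (Neighbour-sym (Neighbour-next (next is))) (next-next≢ is)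
                        below-after-a

      a′→s : Arc a′ s
      a′→s = antenna-arc (Neighbour-prev is) (Neighbour-sym (Neighbour-prev (prev is))) (prev-prev≢ is)
                         below-before-a′

      arc-into-s⇒InSH : ∀ {k} → Neighbour is k → Arc (vtx k) s → InSH H (vtx k)
      arc-into-s⇒InSH {k} is-k k→s = (k , refl) , λ t (t≤k , t≢k) t∈H → not-strictly-above t≤k t≢k (t≰s t≤k t∈H)
        where
        t≰s : ∀ {t} → Ancestor t (vtx k) → InH H t → ¬ Ancestor t s
        t≰s {t} t≤k t∈H t≤s with t ≟ s
        ... | yes refl = adj⇒¬ancestor (Neighbour⇒adj is-k) t≤k
        ... | no t≢s = proj₂ s∈SH _ (t≤s , t≢s) t∈H
        not-strictly-above : ∀ {t} → Ancestor t (vtx k) → t ≢ vtx k → ¬ Ancestor t s → ⊥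
        not-strictly-above t≤k t≢k t≰s with adj-leaving-subtree (inj₁ k→s) t≤k t≰s
        ... | inj₁ k≡t = t≢k (sym k≡t)
        ... | inj₂ (_ , s→k) = arc-asym k→s s→k

      below-or-antenna : ∀ v → InH H v → Ancestor s v ⊎ v ≡ a ⊎ v ≡ a′
      below-or-antenna v (i , refl) = closed-under-next Q Q-next {is} (inj₁ (ancestor-refl s)) i
        where
        Q : Fin len → Set
        Q i = Ancestor s (vtx i) ⊎ vtx i ≡ a ⊎ vtx i ≡ a′
        Q-next : ∀ i → Q i → Q (next i)
        Q-next i (inj₂ (inj₁ i≡a)) rewrite vtx-inj i≡a = inj₁ below-after-a
        Q-next i (inj₂ (inj₂ i≡a′)) rewrite vtx-inj i≡a′ =
          inj₁ (subst (Ancestor s ∘ vtx) (Next-functional (Next-prev is) (Next-next (prev is))) (ancestor-refl s))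
        Q-next i (inj₁ s≤i) with ancestor? s (vtx (next i))
        ... | yes s≤next-i = inj₁ s≤next-i
        ... | no s≰next-i with adj-leaving-subtree (Neighbour⇒adj (Neighbour-next i)) s≤i s≰next-i
        ...   | inj₁ i≡s = inj₂ (inj₁ (cong (vtx ∘ next) (vtx-inj i≡s)))
        ...   | inj₂ (next-i→s , _) with neighbours (adj⇒Neighbour {is} {next i} (inj₂ next-i→s))
        ...     | inj₁ next-i≡next-is = inj₂ (inj₁ (cong vtx next-i≡next-is))
        ...     | inj₂ next-i≡prev-is = inj₂ (inj₂ (cong vtx next-i≡prev-is))

      antennas-nonadjacent : ¬ Adj a a′
      antennas-nonadjacent a-a′
        with only-two-neighbours (Neighbour-sym (Neighbour-next is)) (Neighbour-next (next is))
                                 (≢-sym (next-next≢ is)) (prev is) (adj⇒Neighbour a-a′)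
      ... | inj₁ prev≡is = Neighbour-irrefl (subst (Neighbour is) prev≡is (Neighbour-prev is))
      ... | inj₂ prev≡next-next = adj⇒¬ancestor (Neighbour⇒adj (Neighbour-prev is))
                                    (subst (Ancestor s ∘ vtx) (sym prev≡next-next) below-after-a)

      InSH⇔ : ∀ x → InSH H x ⇔ (x ≡ s ⊎ x ≡ a ⊎ x ≡ a′)
      InSH⇔ x = mk⇔ to from
        where
        to : InSH H x → x ≡ s ⊎ x ≡ a ⊎ x ≡ a′
        to (x∈H , x∈SH) with below-or-antenna x x∈H
        ... | inj₂ antenna = inj₂ antenna
        ... | inj₁ s≤x with x ≟ s
        ...   | yes x≡s = inj₁ x≡s
        ...   | no x≢s = ⊥-elim (x∈SH s (s≤x , λ s≡x → x≢s (sym s≡x)) (is , refl))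
        from : x ≡ s ⊎ x ≡ a ⊎ x ≡ a′ → InSH H x
        from (inj₁ refl) = s∈SH
        from (inj₂ (inj₁ refl)) = arc-into-s⇒InSH (Neighbour-next is) a→s
        from (inj₂ (inj₂ refl)) = arc-into-s⇒InSH (Neighbour-prev is) a′→s

      pivotStructure : PivotStructure H s a a′
      pivotStructure = record
        { pivotData = adj-irrefl (Neighbour⇒adj (Neighbour-next is)) ,
                      adj-irrefl (Neighbour⇒adj (Neighbour-prev is)) ,
                      (λ a≡a′ → next≢prev is (vtx-inj a≡a′)) , InSH⇔ ,
                      a→s , a′→s , arc-asym a→s , arc-asym a′→s ,
                      (λ a→a′ → antennas-nonadjacent (inj₁ a→a′)) , (λ a′→a → antennas-nonadjacent (inj₂ a′→a))
        ; below-or-antenna = below-or-antenna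
        ; pivot-neighbours = λ { v (j , refl) s-v →
                                 Sum.map (cong vtx) (cong vtx) (neighbours (adj⇒Neighbour {is} {j} s-v)) }
        }

    module Antichain (antichain : ∀ i → ¬ HasStrictAncestorInH (vtx i)) where
      some-arc-in : ∀ i → ∃[ j ] Arc (vtx j) (vtx i)
      some-arc-in i with Neighbour⇒adj (Neighbour-next i) | Neighbour⇒adj (Neighbour-prev i)
      ... | inj₂ next→i | _ = next i , next→i
      ... | inj₁ _ | inj₂ prev→i = prev i , prev→i
      ... | inj₁ i→next | inj₁ i→prev with arc-heads-comparable i→next i→prev
      ...   | inj₁ next≤prev = ⊥-elim (antichain (prev i) (next i , next≤prev , next≢prev i ∘ vtx-inj))
      ...   | inj₂ prev≤next = ⊥-elim (antichain (next i) (prev i , prev≤next , next≢prev i ∘ vtx-inj ∘ sym))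

      shallowest : Fin len
      shallowest = argmin (depth ∘ vtx) first (allFin len)

      shallowest-minimal : ∀ k → depth (vtx shallowest) ≤ depth (vtx k)
      shallowest-minimal k = All.lookup (f[argmin]≤f[xs] first (allFin len)) (∈-allFin k)

      -- The tail j of an arc into a shallowest vertex is itself shallowest, so the arc into j
      -- comes from no deeper level and makes j a last-born; but last-borns have no out-arcs.
      absurd : ⊥
      absurd with some-arc-in shallowest
      ... | j , j→u with some-arc-in j
      ...   | k , k→j = arc-tail-not-lastBorn j→u (arc-to-shallower⇒lastBorn k→j
                          (≤-trans (arc-depth-≤ j→u) (shallowest-minimal k)))

    pivot-exists : ∃[ p ] ∃[ a ] ∃[ a′ ] PivotStructure H p a a′
    pivot-exists with any? (λ i → hasStrictAncestorInH? (vtx i))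
    ... | no antichain = ⊥-elim (Antichain.absurd (λ i has → antichain (i , has)))
    ... | yes (iu , iv , v≤u , v≢u) with InSH-ancestor (iv , refl)
    ...   | s , s≤v , s∈SH@((is , refl) , _) =
            _ , _ , _ , PivotFromDescendant.pivotStructure is s∈SH iu (ancestor-trans s≤v v≤u) s≢u
      where
      s≢u : s ≢ vtx iu
      s≢u s≡u = v≢u (ancestor-antisym v≤u (subst (λ t → Ancestor t (vtx iv)) s≡u s≤v))

  module Roles {H : Hole} {p a a′ : Fin n} (ps : PivotStructure H p a a′) where
    open PivotStructure ps public
    open DerivedGraph B S using (IsPivot; IsSubordinate)

    Antenna : Fin n → Set
    Antenna v = v ≡ a ⊎ v ≡ a′

    Below : Fin n → Set
    Below v = Ancestor p v × v ≢ p

    data Role (v : Fin n) : Set where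
      pivot : v ≡ p → Role v
      antenna : Antenna v → Role v
      subordinate : Below v → Role v

    role : ∀ v → InH H v → Role v
    role v v∈H with v ≟ p | below-or-antenna v v∈H
    ... | yes v≡p | _ = pivot v≡p
    ... | no v≢p | inj₁ p≤v = subordinate (p≤v , v≢p)
    ... | no _ | inj₂ ant = antenna ant

    pivot∈H : InH H p
    pivot∈H = let (_ , _ , _ , InSH⇔ , _) = pivotData in proj₁ (Equivalence.from (InSH⇔ p) (inj₁ refl))

    antenna-arc : ∀ {v} → Antenna v → Arc v p
    antenna-arc (inj₁ refl) = let (_ , _ , _ , _ , a→p , _) = pivotData in a→p
    antenna-arc (inj₂ refl) = let (_ , _ , _ , _ , _ , a′→p , _) = pivotData in a′→p

    antenna-not-below : ∀ {v} → Antenna v → ¬ Ancestor p v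
    antenna-not-below ant = adj⇒¬ancestor (inj₂ (antenna-arc ant))

    antennas-nonadjacent : ∀ {u v} → Antenna u → Antenna v → ¬ Adj u v
    antennas-nonadjacent (inj₁ refl) (inj₁ refl) u-v = adj-irrefl u-v refl
    antennas-nonadjacent (inj₂ refl) (inj₂ refl) u-v = adj-irrefl u-v refl
    antennas-nonadjacent (inj₁ refl) (inj₂ refl) u-v with pivotData
    ... | (_ , _ , _ , _ , _ , _ , _ , _ , ¬a→a′ , ¬a′→a) = Sum.[ ¬a→a′ , ¬a′→a ] u-v
    antennas-nonadjacent (inj₂ refl) (inj₁ refl) u-v with pivotData
    ... | (_ , _ , _ , _ , _ , _ , _ , _ , ¬a→a′ , ¬a′→a) = Sum.[ ¬a′→a , ¬a→a′ ] u-v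

    antenna-adj⇒arc : ∀ {u v} → Antenna u → InH H v → Adj u v → Arc u v
    antenna-adj⇒arc {u} {v} ant v∈H u-v with role v v∈H
    ... | pivot refl = antenna-arc ant
    ... | antenna ant′ = ⊥-elim (antennas-nonadjacent ant ant′ u-v)
    ... | subordinate (p≤v , v≢p) with adj-leaving-subtree (adj-sym u-v) p≤v (antenna-not-below ant)
    ...   | inj₁ v≡p = ⊥-elim (v≢p v≡p)
    ...   | inj₂ (_ , u→v) = u→v

    non-pivot-adj : ∀ {u v} → InH H u → u ≢ p → InH H v → Adj u v → Below u ⊎ Arc u v
    non-pivot-adj {u} u∈H u≢p v∈H u-v with role u u∈H
    ... | pivot u≡p = ⊥-elim (u≢p u≡p)
    ... | antenna ant = inj₂ (antenna-adj⇒arc ant v∈H u-v)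
    ... | subordinate below = inj₁ below

    antenna-subordinate-neighbour : ∀ {u} → Antenna u → InH H u → ∃[ w ] InH H w × Below w × Arc u w
    antenna-subordinate-neighbour ant u∈H with OnHole.other-neighbour H u∈H p
    ... | w , w∈H , u-w , w≢p with role w w∈H
    ...   | pivot w≡p = ⊥-elim (w≢p w≡p)
    ...   | antenna ant′ = ⊥-elim (antennas-nonadjacent ant ant′ u-w)
    ...   | subordinate below = w , w∈H , below , antenna-adj⇒arc ant w∈H u-w

    isPivot : IsPivot H p
    isPivot = a , a′ , pivotData

    isSubordinate : ∀ {v} → InH H v → Below v → IsSubordinate H v
    isSubordinate v∈H (p≤v , v≢p) =
      v∈H , p , a , a′ , pivotData , v≢p , (λ v≡a → antenna-not-below (inj₁ v≡a) p≤v) ,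
                                          (λ v≡a′ → antenna-not-below (inj₂ v≡a′) p≤v)

module DominoPivots {n : ℕ} (B : BurlingTree n) (S : Fin n → Set) where
  open BurlingTree B
  open RootedTree tree
  open TreeNotions tree
  open Ancestry tree
  open BurlingArcs B
  open DerivedGraph B S using (Hole; InH; IsDomino; IsPivot; IsSubordinate)
  open HolePivot B S

  record Domino (x y : Fin n) (H₁ H₂ : Hole) : Set where
    field
      x-y : Adj x y
      x∈H₁ : InH H₁ x
      y∈H₁ : InH H₁ y
      x∈H₂ : InH H₂ x
      y∈H₂ : InH H₂ y
      common : ∀ v → InH H₁ v → InH H₂ v → v ≡ x ⊎ v ≡ y
      edge₁₂ : ∀ u v → InH H₁ u → ¬ InH H₂ u → InH H₂ v → Adj u v → v ≡ x ⊎ v ≡ y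
      edge₂₁ : ∀ u v → InH H₂ u → ¬ InH H₁ u → InH H₁ v → Adj u v → v ≡ x ⊎ v ≡ y

  isDomino⇒Domino : ∀ {x y H₁ H₂} → IsDomino x y H₁ H₂ → Domino x y H₁ H₂
  isDomino⇒Domino {x} {y} {H₁} {H₂} D = record
    { x-y = edge-xy
    ; x∈H₁ = let (i , _ , _ , eq , _) = xy∈H₁ in i , eq
    ; y∈H₁ = let (_ , j , _ , _ , eq) = xy∈H₁ in j , eq
    ; x∈H₂ = let (i , _ , _ , eq , _) = xy∈H₂ in i , eq
    ; y∈H₂ = let (_ , j , _ , _ , eq) = xy∈H₂ in j , eq
    ; common = common
    ; edge₁₂ = edge₁₂
    ; edge₂₁ = edge₂₁
    }
    where
    open IsDomino D
    common : ∀ v → InH H₁ v → InH H₂ v → v ≡ x ⊎ v ≡ y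
    common v v∈H₁ v∈H₂ = Equivalence.to (intersection v) (v∈H₁ , v∈H₂)
    edge₁₂ : ∀ u v → InH H₁ u → ¬ InH H₂ u → InH H₂ v → Adj u v → v ≡ x ⊎ v ≡ y
    edge₁₂ u v u∈H₁ u∉H₂ v∈H₂ u-v
      with only-hole-edges u v (Equivalence.from (cover u) (inj₁ u∈H₁)) (Equivalence.from (cover v) (inj₂ v∈H₂)) u-v
    ... | inj₁ (_ , j , _ , _ , eq) = common v (j , eq) v∈H₂
    ... | inj₂ (i , _ , _ , eq , _) = ⊥-elim (u∉H₂ (i , eq))
    edge₂₁ : ∀ u v → InH H₂ u → ¬ InH H₁ u → InH H₁ v → Adj u v → v ≡ x ⊎ v ≡ y
    edge₂₁ u v u∈H₂ u∉H₁ v∈H₁ u-v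
      with only-hole-edges u v (Equivalence.from (cover u) (inj₂ u∈H₂)) (Equivalence.from (cover v) (inj₁ v∈H₁)) u-v
    ... | inj₁ (i , _ , _ , eq , _) = ⊥-elim (u∉H₁ (i , eq))
    ... | inj₂ (_ , j , _ , _ , eq) = common v v∈H₁ (j , eq)

  swap-holes : ∀ {x y H₁ H₂} → Domino x y H₁ H₂ → Domino x y H₂ H₁
  swap-holes D = record
    { x-y = x-y ; x∈H₁ = x∈H₂ ; y∈H₁ = y∈H₂ ; x∈H₂ = x∈H₁ ; y∈H₂ = y∈H₁
    ; common = λ v v∈H₂ v∈H₁ → common v v∈H₁ v∈H₂ ; edge₁₂ = edge₂₁ ; edge₂₁ = edge₁₂ }
    where open Domino D

  swap-ends : ∀ {x y H₁ H₂} → Domino x y H₁ H₂ → Domino y x H₁ H₂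
  swap-ends D = record
    { x-y = adj-sym x-y ; x∈H₁ = y∈H₁ ; y∈H₁ = x∈H₁ ; x∈H₂ = y∈H₂ ; y∈H₂ = x∈H₂
    ; common = λ v v∈H₁ v∈H₂ → Sum.swap (common v v∈H₁ v∈H₂)
    ; edge₁₂ = λ u v u∈H₁ u∉H₂ v∈H₂ u-v → Sum.swap (edge₁₂ u v u∈H₁ u∉H₂ v∈H₂ u-v)
    ; edge₂₁ = λ u v u∈H₂ u∉H₁ v∈H₁ u-v → Sum.swap (edge₂₁ u v u∈H₂ u∉H₁ v∈H₁ u-v) }
    where open Domino D

  private
    variable
      x y s : Fin n
      H₁ H₂ : Hole
      p₁ a₁ a₁′ p₂ a₂ a₂′ : Fin n

  only-ends-shared : Domino x y H₁ H₂ → ∀ {v} → InH H₁ v → v ≢ x → v ≢ y → ¬ InH H₂ v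
  only-ends-shared D v∈H₁ v≢x v≢y v∈H₂ = Sum.[ v≢x , v≢y ] (Domino.common D _ v∈H₁ v∈H₂)

  y-neighbour-not-shared : Domino x y H₁ H₂ → ∀ {w} → InH H₁ w → w ≢ x → Adj y w → ¬ InH H₂ w
  y-neighbour-not-shared D w∈H₁ w≢x y-w = only-ends-shared D w∈H₁ w≢x (λ w≡y → adj-irrefl y-w (sym w≡y))

  -- H₂ can leave the subtree of s only along an arc into s, which must come from x or y;
  -- comparability rules out x, so y is the only vertex through which H₂ leaves the subtree.
  below-outside-vertex : Domino x y H₁ H₂ → InH H₁ s → ¬ InH H₂ s → Ancestor s x ⊎ Ancestor x s →
                         ∃[ v ] InH H₂ v × Ancestor s v → ∀ w → InH H₂ w → Ancestor s w ⊎ w ≡ y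
  below-outside-vertex {x} {y} {H₁} {H₂} {s} D s∈H₁ s∉H₂ s~x (_ , (i , refl) , s≤v) w (k , refl)
    with ancestor? s w | w ≟ y
  ... | yes s≤w | _ = inj₁ s≤w
  ... | no _ | yes w≡y = inj₂ w≡y
  ... | no s≰w | no w≢y =
        ⊥-elim (OnHole.no-separating-vertex H₂ (Ancestor s) (ancestor? s) y exits (i , s≤v) (k , s≰w , w≢y))
    where
    open Hole H₂
    open Cyclic len (≤-trans (n≤1+n 3) len≥4)
    exits : ∀ i j → Neighbour i j → Ancestor s (vtx i) → ¬ Ancestor s (vtx j) → vtx j ≡ y
    exits i j i-j s≤i s≰j with adj-leaving-subtree (OnHole.Neighbour⇒adj H₂ i-j) s≤i s≰j
    ... | inj₁ i≡s = ⊥-elim (s∉H₂ (i , i≡s))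
    ... | inj₂ (j→s , _) with Domino.edge₁₂ D s (vtx j) s∈H₁ s∉H₂ (j , refl) (inj₂ j→s)
    ...   | inj₂ j≡y = j≡y
    ...   | inj₁ refl = ⊥-elim (Sum.[ s≰j , adj⇒¬ancestor (inj₁ j→s) ] s~x)

  no-descendant-across : Domino x y H₁ H₂ → InH H₁ s → ¬ InH H₂ s → Ancestor x s → s ≢ x →
                         ∀ {v} → InH H₂ v → ¬ Ancestor s v
  no-descendant-across {x} D s∈H₁ s∉H₂ x≤s s≢x v∈H₂ s≤v
    with below-outside-vertex D s∈H₁ s∉H₂ (inj₂ x≤s) (_ , v∈H₂ , s≤v) x (Domino.x∈H₂ D)
  ... | inj₁ s≤x = s≢x (ancestor-antisym s≤x x≤s)
  ... | inj₂ x≡y = adj-irrefl (Domino.x-y D) x≡y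

  above-y⇒above-other-hole : Domino x y H₁ H₂ → InH H₁ s → s ≢ x → Ancestor s y → s ≢ y →
                             ∀ {w} → InH H₂ w → w ≢ x → Ancestor s w
  above-y⇒above-other-hole {y = y} D s∈H₁ s≢x s≤y s≢y {w} w∈H₂ w≢x
    with below-outside-vertex (swap-ends D) s∈H₁ (only-ends-shared D s∈H₁ s≢x s≢y) (inj₁ s≤y)
                              (y , Domino.y∈H₂ D , s≤y) w w∈H₂
  ... | inj₁ s≤w = s≤w
  ... | inj₂ w≡x = ⊥-elim (w≢x w≡x)

  -- Each pivot lies above the other, since both are above y and avoid x.
  subordinate-in-both⇒⊥ : Domino x y H₁ H₂ →
                          (ps₁ : PivotStructure H₁ p₁ a₁ a₁′) (ps₂ : PivotStructure H₂ p₂ a₂ a₂′) →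
                          Roles.Below ps₁ y → Roles.Below ps₂ y → p₁ ≢ x → p₂ ≢ x → ⊥
  subordinate-in-both⇒⊥ {H₂ = H₂} {p₁ = p₁} {p₂ = p₂} D ps₁ ps₂ (p₁≤y , y≢p₁) (p₂≤y , y≢p₂) p₁≢x p₂≢x =
    only-ends-shared D R₁.pivot∈H p₁≢x (≢-sym y≢p₁) (subst (InH H₂) (sym p₁≡p₂) R₂.pivot∈H)
    where
    module R₁ = Roles ps₁
    module R₂ = Roles ps₂
    p₁≡p₂ : p₁ ≡ p₂
    p₁≡p₂ = ancestor-antisym
      (above-y⇒above-other-hole D R₁.pivot∈H p₁≢x p₁≤y (≢-sym y≢p₁) R₂.pivot∈H p₂≢x)
      (above-y⇒above-other-hole (swap-holes D) R₂.pivot∈H p₂≢x p₂≤y (≢-sym y≢p₂) R₁.pivot∈H p₁≢x)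

  -- The antenna y points to a subordinate wᵢ of each hole; w₁ and w₂ are comparable,
  -- and the upper one would have a descendant in the other hole.
  both-pivots⇒⊥ : Domino x y H₁ H₂ →
                  (ps₁ : PivotStructure H₁ p₁ a₁ a₁′) (ps₂ : PivotStructure H₂ p₂ a₂ a₂′) →
                  x ≡ p₁ → x ≡ p₂ → ⊥
  both-pivots⇒⊥ D ps₁ ps₂ refl refl
    with R₁.antenna-subordinate-neighbour (R₁.pivot-neighbours _ y∈H₁ x-y) y∈H₁
       | R₂.antenna-subordinate-neighbour (R₂.pivot-neighbours _ y∈H₂ x-y) y∈H₂
    where
    open Domino D
    module R₁ = Roles ps₁
    module R₂ = Roles ps₂
  ... | w₁ , w₁∈H₁ , (x≤w₁ , w₁≢x) , y→w₁ | w₂ , w₂∈H₂ , (x≤w₂ , w₂≢x) , y→w₂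
      with arc-heads-comparable y→w₁ y→w₂
  ...   | inj₁ w₁≤w₂ = no-descendant-across D w₁∈H₁ (y-neighbour-not-shared D w₁∈H₁ w₁≢x (inj₁ y→w₁))
                         x≤w₁ w₁≢x w₂∈H₂ w₁≤w₂
  ...   | inj₂ w₂≤w₁ = no-descendant-across (swap-holes D) w₂∈H₂
                         (y-neighbour-not-shared (swap-holes D) w₂∈H₂ w₂≢x (inj₁ y→w₂)) x≤w₂ w₂≢x w₁∈H₁ w₂≤w₁

  pivot-at-x⇒subordinate-in-other : Domino x y H₁ H₂ →
                                    (ps₁ : PivotStructure H₁ p₁ a₁ a₁′) (ps₂ : PivotStructure H₂ p₂ a₂ a₂′) →
                                    x ≡ p₁ → IsPivot H₁ x × IsSubordinate H₂ x
  pivot-at-x⇒subordinate-in-other {x} {H₁ = H₁} {H₂ = H₂} D ps₁ ps₂ refl = from-role (R₂.role x x∈H₂)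
    where
    open Domino D
    module R₁ = Roles ps₁
    module R₂ = Roles ps₂
    from-role : R₂.Role x → IsPivot H₁ x × IsSubordinate H₂ x
    from-role (R₂.subordinate below) = R₁.isPivot , R₂.isSubordinate x∈H₂ below
    from-role (R₂.pivot x≡p₂) = ⊥-elim (both-pivots⇒⊥ D ps₁ ps₂ refl x≡p₂)
    from-role (R₂.antenna ant) = ⊥-elim (arc-asym (R₂.antenna-adj⇒arc ant y∈H₂ x-y)
                                                  (R₁.antenna-arc (R₁.pivot-neighbours _ y∈H₁ x-y)))

  no-pivot-at-ends⇒⊥ : Domino x y H₁ H₂ →
                       (ps₁ : PivotStructure H₁ p₁ a₁ a₁′) (ps₂ : PivotStructure H₂ p₂ a₂ a₂′) →
                       x ≢ p₁ → y ≢ p₁ → x ≢ p₂ → y ≢ p₂ → ⊥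
  no-pivot-at-ends⇒⊥ {x} {y} D ps₁ ps₂ x≢p₁ y≢p₁ x≢p₂ y≢p₂ =
    combine (R₁.non-pivot-adj x∈H₁ x≢p₁ y∈H₁ x-y) (R₂.non-pivot-adj x∈H₂ x≢p₂ y∈H₂ x-y)
            (R₁.non-pivot-adj y∈H₁ y≢p₁ x∈H₁ (adj-sym x-y)) (R₂.non-pivot-adj y∈H₂ y≢p₂ x∈H₂ (adj-sym x-y))
    where
    open Domino D
    module R₁ = Roles ps₁
    module R₂ = Roles ps₂
    combine : R₁.Below x ⊎ Arc x y → R₂.Below x ⊎ Arc x y → R₁.Below y ⊎ Arc y x → R₂.Below y ⊎ Arc y x → ⊥
    combine (inj₁ x-below₁) (inj₁ x-below₂) _ _ =
      subordinate-in-both⇒⊥ (swap-ends D) ps₁ ps₂ x-below₁ x-below₂ (≢-sym y≢p₁) (≢-sym y≢p₂)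
    combine _ _ (inj₁ y-below₁) (inj₁ y-below₂) =
      subordinate-in-both⇒⊥ D ps₁ ps₂ y-below₁ y-below₂ (≢-sym x≢p₁) (≢-sym x≢p₂)
    combine (inj₂ x→y) _ (inj₂ y→x) _ = arc-asym x→y y→x
    combine (inj₂ x→y) _ _ (inj₂ y→x) = arc-asym x→y y→x
    combine _ (inj₂ x→y) (inj₂ y→x) _ = arc-asym x→y y→x
    combine _ (inj₂ x→y) _ (inj₂ y→x) = arc-asym x→y y→x

lemma6p3 : {n : ℕ} (B : BurlingTree n) (S : Fin n → Set) (x y : Fin n)
           (H₁ H₂ : DerivedGraph.Hole B S) →
           DerivedGraph.IsDomino B S x y H₁ H₂ →
           ∃[ z ] ((z ≡ x ⊎ z ≡ y) ×
             ((DerivedGraph.IsPivot B S H₁ z × DerivedGraph.IsSubordinate B S H₂ z) ⊎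
              (DerivedGraph.IsPivot B S H₂ z × DerivedGraph.IsSubordinate B S H₁ z)))
lemma6p3 B S x y H₁ H₂ isDomino = choose (OnHole.pivot-exists H₁) (OnHole.pivot-exists H₂)
  where
  open HolePivot B S
  open DominoPivots B S
  open DerivedGraph B S using (IsPivot; IsSubordinate)
  D : Domino x y H₁ H₂
  D = isDomino⇒Domino isDomino
  choose : ∃[ p₁ ] ∃[ a₁ ] ∃[ a₁′ ] PivotStructure H₁ p₁ a₁ a₁′ →
           ∃[ p₂ ] ∃[ a₂ ] ∃[ a₂′ ] PivotStructure H₂ p₂ a₂ a₂′ →
           ∃[ z ] ((z ≡ x ⊎ z ≡ y) ×
             ((IsPivot H₁ z × IsSubordinate H₂ z) ⊎ (IsPivot H₂ z × IsSubordinate H₁ z)))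
  choose (p₁ , _ , _ , ps₁) (p₂ , _ , _ , ps₂) with x ≟ p₁ | y ≟ p₁ | x ≟ p₂ | y ≟ p₂
  ... | yes x≡p₁ | _ | _ | _ = x , inj₁ refl , inj₁ (pivot-at-x⇒subordinate-in-other D ps₁ ps₂ x≡p₁)
  ... | _ | yes y≡p₁ | _ | _ = y , inj₂ refl , inj₁ (pivot-at-x⇒subordinate-in-other (swap-ends D) ps₁ ps₂ y≡p₁)
  ... | _ | _ | yes x≡p₂ | _ = x , inj₁ refl , inj₂ (pivot-at-x⇒subordinate-in-other (swap-holes D) ps₂ ps₁ x≡p₂)
  ... | _ | _ | _ | yes y≡p₂ =
        y , inj₂ refl , inj₂ (pivot-at-x⇒subordinate-in-other (swap-holes (swap-ends D)) ps₂ ps₁ y≡p₂)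
  ... | no x≢p₁ | no y≢p₁ | no x≢p₂ | no y≢p₂ = ⊥-elim (no-pivot-at-ends⇒⊥ D ps₁ ps₂ x≢p₁ y≢p₁ x≢p₂ y≢p₂)
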